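{- Let $Q$ be a base quantale and $\Omega$ a type. The forgetful functor $U:\mathbf{Q\text{ - }Sup\text{ - }\Omega\text{ - }Alg}\to\mathbf{Set}$ from the category of $Q$-sup-algebras of type $\Omega$ (with $Q$-sup-algebra homomorphisms) to the category of sets has a left adjoint.
   Context: A base quantale is a commutative quantale $Q$ with a multiplicative unit $1$ (not necessarily the top); $q\to s=\bigvee\{r\mid q\cdot r\le s\}$. A type $\Omega$ is a set of function symbols with arities in $\{0,1,2,\dots\}$; an $\Omega$-algebra is a set with operations of the corresponding arities. A $Q$-order on $X$ is $e:X\times X\to Q$ with $e(x,x)\ge1$, $e(x,y)\cdot e(y,z)\le e(x,z)$, and $e(x,y)\ge1,e(y,x)\ge1\Rightarrow x=y$. For $M:X\to Q$, $s$ is a $Q$-join $\bigsqcup M$ if $M(x)\le e(x,s)$ for all $x$ and $\bigwedge_x(M(x)\to e(x,y))\le e(s,y)$ for all $y$; a $Q$-sup-lattice is a $Q$-ordered set in which every $M\in Q^X$ has a $Q$-join. For $f:X\to Y$, $f^\to_Q(M)(y)=\bigvee_{x\in f^{ -1}(y)}M(x)$; $f$ is $Q$-join-preserving if whenever $\bigsqcup M$ exists, $\bigsqcup f^\to_Q(M)$ exists and equals $f(\bigsqcup M)$. A $Q$-sup-algebra of type $\Omega$ is a $Q$-sup-lattice that is an $\Omega$-algebra in which each operation of positive arity is $Q$-join-preserving in each argument separately. A $Q$-sup-algebra homomorphism is a $Q$-join-preserving map preserving all operations (including nullary ones). $U$ sends a $Q$-sup-algebra to its underlying set. -}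

module Defs where

open import Level using (Level; suc; _⊔_)
open import Data.Nat using (ℕ)
open import Data.Fin using (Fin)
open import Data.Product using (Σ; _×_; _,_)
open import Data.Vec.Functional using (updateAt)
open import Function using (const; _∘_)
open import Relation.Binary.Bundles using (Poset; Setoid)

-- Base quantales: a commutative quantale with unit 1 (not necessarily
-- the top).

record BaseQuantale (ℓ : Level) : Set (suc ℓ) where
  field
    poset : Poset ℓ ℓ ℓ
  open Poset poset public
  field
    ⋁        : {I : Set ℓ} → (I → Carrier) → Carrier
    ⋁-upper  : {I : Set ℓ} (f : I → Carrier) (i : I) → f i ≤ ⋁ f
    ⋁-least  : {I : Set ℓ} (f : I → Carrier) (b : Carrier) →
               (∀ i → f i ≤ b) → ⋁ f ≤ b
    _∙_      : Carrier → Carrier → Carrier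
    1q       : Carrier
    ∙-cong   : ∀ {a a′ b b′} → a ≈ a′ → b ≈ b′ → (a ∙ b) ≈ (a′ ∙ b′)
    ∙-assoc  : ∀ a b c → ((a ∙ b) ∙ c) ≈ (a ∙ (b ∙ c))
    ∙-comm   : ∀ a b → (a ∙ b) ≈ (b ∙ a)
    ∙-unitˡ  : ∀ a → (1q ∙ a) ≈ a
    ∙-distrib-⋁ : ∀ a {I : Set ℓ} (f : I → Carrier) →
                  (a ∙ ⋁ f) ≈ ⋁ (λ i → a ∙ f i)

  ⋀ : {I : Set ℓ} → (I → Carrier) → Carrier
  ⋀ {I} f = ⋁ {Σ Carrier (λ q → ∀ i → q ≤ f i)} (λ p → Data.Product.proj₁ p)

  _⇒_ : Carrier → Carrier → Carrier
  q ⇒ s = ⋁ {Σ Carrier (λ r → (q ∙ r) ≤ s)} (λ p → Data.Product.proj₁ p)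

-- Types (signatures) Ω: a set of function symbols with arities.

record Signature (ℓ : Level) : Set (suc ℓ) where
  field
    Sym   : Set ℓ
    arity : Sym → ℕ

module _ {ℓ : Level} (Q : BaseQuantale ℓ) where
  private module Q = BaseQuantale Q
  open Q using (_≤_; _⇒_; ⋀; ⋁; 1q; _∙_)

  record IsQOrder (X : Setoid ℓ ℓ) (e : Setoid.Carrier X → Setoid.Carrier X → Q.Carrier)
         : Set ℓ where
    open Setoid X renaming (Carrier to |X|)
    field
      e-cong  : ∀ {x x′ y y′} → x ≈ x′ → y ≈ y′ → e x y Q.≈ e x′ y′
      e-refl  : ∀ x → 1q ≤ e x x
      e-trans : ∀ x y z → (e x y ∙ e y z) ≤ e x z
      e-antisym : ∀ {x y} → 1q ≤ e x y → 1q ≤ e y x → x ≈ y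

  IsQJoin : {X : Set ℓ} (e : X → X → Q.Carrier) → (X → Q.Carrier) → X → Set ℓ
  IsQJoin {X} e M s =
    (∀ x → M x ≤ e x s) ×
    (∀ y → ⋀ (λ x → M x ⇒ e x y) ≤ e s y)

  image : {X Y : Setoid ℓ ℓ} → (Setoid.Carrier X → Setoid.Carrier Y) →
          (Setoid.Carrier X → Q.Carrier) → Setoid.Carrier Y → Q.Carrier
  image {X} {Y} f M y =
    ⋁ {Σ (Setoid.Carrier X) (λ x → Setoid._≈_ Y (f x) y)} (λ p → M (Data.Product.proj₁ p))

  QJoinPreserving : {X Y : Setoid ℓ ℓ}
    (eX : Setoid.Carrier X → Setoid.Carrier X → Q.Carrier)
    (eY : Setoid.Carrier Y → Setoid.Carrier Y → Q.Carrier)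
    (f : Setoid.Carrier X → Setoid.Carrier Y) → Set ℓ
  QJoinPreserving {X} {Y} eX eY f =
    ∀ (M : Setoid.Carrier X → Q.Carrier) (s : Setoid.Carrier X) →
      IsQJoin eX M s → IsQJoin eY (image {X} {Y} f M) (f s)

  record SupAlg (Ω : Signature ℓ) : Set (suc ℓ) where
    open Signature Ω
    field
      setoid : Setoid ℓ ℓ
    open Setoid setoid public
    field
      e        : Carrier → Carrier → Q.Carrier
      isQOrder : IsQOrder setoid e
      ⨆        : (Carrier → Q.Carrier) → Carrier
      ⨆-isJoin : ∀ M → IsQJoin e M (⨆ M)
      op       : (σ : Sym) → (Fin (arity σ) → Carrier) → Carrier
      op-cong  : ∀ σ {xs ys} → (∀ i → xs i ≈ ys i) → op σ xs ≈ op σ ys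
      -- each operation of positive arity is Q-join-preserving in each
      -- argument separately (vacuous for nullary operations)
      op-preserves : ∀ σ (xs : Fin (arity σ) → Carrier) (i : Fin (arity σ)) →
        QJoinPreserving {setoid} {setoid} e e (λ x → op σ (updateAt xs i (const x)))

  record SupAlgHom {Ω : Signature ℓ} (A B : SupAlg Ω) : Set ℓ where
    private
      module A = SupAlg A
      module B = SupAlg B
    open Signature Ω
    field
      fun       : A.Carrier → B.Carrier
      fun-cong  : ∀ {x y} → x A.≈ y → fun x B.≈ fun y
      fun-preservesJoins : QJoinPreserving {A.setoid} {B.setoid} A.e B.e fun
      fun-preservesOps   : ∀ σ (xs : Fin (arity σ) → A.Carrier) →
                           fun (A.op σ xs) B.≈ B.op σ (fun ∘ xs)

  -- "U : Q-Sup-Ω-Alg → Set has a left adjoint", in the universal-arrow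
  -- formulation: for every set X there is an algebra F X and a map
  -- η : X → U(F X) such that every map f : X → U A factors as U h ∘ η
  -- through a unique homomorphism h : F X → A.
  ForgetfulHasLeftAdjoint : (Ω : Signature ℓ) → Set (suc ℓ)
  ForgetfulHasLeftAdjoint Ω =
    (X : Set ℓ) →
    Σ (SupAlg Ω) λ F →
    Σ (X → SupAlg.Carrier F) λ η →
    (A : SupAlg Ω) (f : X → SupAlg.Carrier A) →
    Σ (SupAlgHom F A) λ h →
      (∀ x → SupAlg._≈_ A (SupAlgHom.fun h (η x)) (f x)) ×
      ((h′ : SupAlgHom F A) →
        (∀ x → SupAlg._≈_ A (SupAlgHom.fun h′ (η x)) (f x)) →
        ∀ y → SupAlg._≈_ A (SupAlgHom.fun h′ y) (SupAlgHom.fun h y))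

-- The free Q-sup-algebra on V is the Q-powerset of the term algebra over V: Q-subsets of terms,
-- ordered by the subsethood degree ⋀ₜ (M t ⇒ N t), with pointwise joins and σ acting by
-- product-weighted images along t⃗ ↦ σ(t⃗); η sends a variable to its singleton. A map f : V → A
-- extends to a Q-subset M as the Q-join in A of the evaluations of the terms, weighted by M.
-- All comparisons are made through cones: by residuation, s is the Q-join of M iff
-- q ≤ e s y ⇔ ∀ x. M x · q ≤ e x y, and elements with the same cones are equal (Yoneda).
-- Preservation of joins then amounts to exchanging joins with products; preservation of an
-- n-ary operation follows by induction on n from its preservation in each argument separately;
-- and uniqueness holds because every Q-subset is the Q-join of its weighted singletons.

module Submission where

open import Algebra.Bundles using (CommutativeSemigroup)
open import Data.Fin using (Fin; zero; suc)
open import Data.Nat using (zero; suc)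
open import Data.Product using (Σ; _×_; _,_; proj₁; proj₂)
open import Data.Vec using (Vec; []; lookup; tabulate)
open import Data.Vec.Properties using (lookup∘tabulate; tabulate∘lookup; tabulate-cong)
open import Data.Vec.Functional as Vector using (foldr; updateAt; head; tail)
open import Defs
open import Function using (_∘_; const; flip; id)
open import Function.Bundles using (_⇔_; mk⇔; Equivalence)
import Function.Properties.Equivalence as ⇔
open import Function.Related.Propositional using (module EquationalReasoning; equivalence)
open import Level using (Level)
open import Relation.Binary.Bundles using (Setoid)
open import Relation.Binary.PropositionalEquality as ≡ using (_≡_)
import Relation.Binary.Reasoning.PartialOrder
import Relation.Binary.Reasoning.Setoid as SetoidReasoning

open Equivalence using (to; from)
module ⇔-Reasoning = EquationalReasoning {k = equivalence}

private
  variable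
    ℓ : Level

Π-cong : ∀ {a b c} {I : Set a} {A : I → Set b} {B : I → Set c} →
         (∀ i → A i ⇔ B i) → (∀ i → A i) ⇔ (∀ i → B i)
Π-cong A⇔B = mk⇔ (λ f i → to (A⇔B i) (f i)) (λ g i → from (A⇔B i) (g i))

Π-swap : ∀ {a b c} {I : Set a} {J : Set b} {R : I → J → Set c} →
         (∀ i j → R i j) ⇔ (∀ j i → R i j)
Π-swap = mk⇔ flip flip

module QuantaleProperties (Q : BaseQuantale ℓ) where
  open BaseQuantale Q public
  module ≤-Reasoning = Relation.Binary.Reasoning.PartialOrder poset

  ∙-commutativeSemigroup : CommutativeSemigroup ℓ ℓ
  ∙-commutativeSemigroup = record
    { _∙_ = _∙_
    ; isCommutativeSemigroup = record
      { isSemigroup = record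
        { isMagma = record { isEquivalence = isEquivalence ; ∙-cong = ∙-cong }
        ; assoc = ∙-assoc }
      ; comm = ∙-comm } }

  open import Algebra.Properties.CommutativeSemigroup ∙-commutativeSemigroup public
    using (xy∙z≈y∙xz; x∙yz≈y∙xz)

  ∙-unitʳ : ∀ a → (a ∙ 1q) ≈ a
  ∙-unitʳ a = Eq.trans (∙-comm a 1q) (∙-unitˡ a)

  ≤-congʳ : ∀ {q a b} → a ≈ b → (q ≤ a) ⇔ (q ≤ b)
  ≤-congʳ a≈b = mk⇔ (λ q≤a → trans q≤a (reflexive a≈b))
                    (λ q≤b → trans q≤b (reflexive (Eq.sym a≈b)))

  ≤-congˡ : ∀ {a b c} → a ≈ b → (a ≤ c) ⇔ (b ≤ c)
  ≤-congˡ a≈b = mk⇔ (trans (reflexive (Eq.sym a≈b))) (trans (reflexive a≈b))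

  ⋁-cong : ∀ {I : Set ℓ} {f g : I → Carrier} → (∀ i → f i ≈ g i) → ⋁ f ≈ ⋁ g
  ⋁-cong {f = f} {g} f≈g = antisym
    (⋁-least f (⋁ g) (λ i → trans (reflexive (f≈g i)) (⋁-upper g i)))
    (⋁-least g (⋁ f) (λ i → trans (reflexive (Eq.sym (f≈g i))) (⋁-upper f i)))

  ⋁-downset : ∀ c → ⋁ {Σ Carrier (_≤ c)} proj₁ ≈ c
  ⋁-downset c = antisym (⋁-least proj₁ c proj₂) (⋁-upper proj₁ (c , refl))

  -- Monotonicity is not an axiom: it comes from distributivity over the join of a downset.
  ∙-monoʳ : ∀ a {b c} → b ≤ c → (a ∙ b) ≤ (a ∙ c)
  ∙-monoʳ a {b} {c} b≤c = begin
    a ∙ b                               ≤⟨ ⋁-upper (λ z → a ∙ proj₁ z) (b , b≤c) ⟩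
    ⋁ (λ (z : Σ Carrier (_≤ c)) → a ∙ proj₁ z) ≈⟨ ∙-distrib-⋁ a proj₁ ⟨
    a ∙ ⋁ proj₁                         ≈⟨ ∙-cong Eq.refl (⋁-downset c) ⟩
    a ∙ c                               ∎
    where open ≤-Reasoning

  ∙-monoˡ : ∀ {a b} c → a ≤ b → (a ∙ c) ≤ (b ∙ c)
  ∙-monoˡ {a} {b} c a≤b = begin
    a ∙ c ≈⟨ ∙-comm a c ⟩
    c ∙ a ≤⟨ ∙-monoʳ c a≤b ⟩
    c ∙ b ≈⟨ ∙-comm c b ⟩
    b ∙ c ∎
    where open ≤-Reasoning

  ∙-mono : ∀ {a b c d} → a ≤ b → c ≤ d → (a ∙ c) ≤ (b ∙ d)
  ∙-mono {b = b} {c} a≤b c≤d = trans (∙-monoˡ c a≤b) (∙-monoʳ b c≤d)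

  ⋁∙≤⇔ : ∀ {I : Set ℓ} (f : I → Carrier) {q c} → ((⋁ f ∙ q) ≤ c) ⇔ (∀ i → (f i ∙ q) ≤ c)
  ⋁∙≤⇔ f {q} {c} = mk⇔
    (λ ⋁f∙q≤c i → trans (∙-monoˡ q (⋁-upper f i)) ⋁f∙q≤c)
    (λ f∙q≤c → begin
      ⋁ f ∙ q           ≈⟨ ∙-comm (⋁ f) q ⟩
      q ∙ ⋁ f           ≈⟨ ∙-distrib-⋁ q f ⟩
      ⋁ (λ i → q ∙ f i) ≤⟨ ⋁-least _ c (λ i → trans (reflexive (∙-comm q (f i))) (f∙q≤c i)) ⟩
      c                 ∎)
    where open ≤-Reasoning

  residuated : ∀ {a b c} → ((a ∙ b) ≤ c) ⇔ (b ≤ (a ⇒ c))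
  residuated {a} {b} {c} = mk⇔
    (λ ab≤c → ⋁-upper proj₁ (b , ab≤c))
    (λ b≤a⇒c → begin
      a ∙ b                 ≤⟨ ∙-monoʳ a b≤a⇒c ⟩
      a ∙ (a ⇒ c)           ≈⟨ ∙-distrib-⋁ a proj₁ ⟩
      ⋁ (λ r → a ∙ proj₁ r) ≤⟨ ⋁-least _ c proj₂ ⟩
      c                     ∎)
    where open ≤-Reasoning

  ≤⋀⇔ : ∀ {I : Set ℓ} (f : I → Carrier) {q} → (q ≤ ⋀ f) ⇔ (∀ i → q ≤ f i)
  ≤⋀⇔ f = mk⇔ (λ q≤⋀f i → trans q≤⋀f (⋁-least proj₁ (f i) (λ z → proj₂ z i)))
              (λ q≤f → ⋁-upper proj₁ (_ , q≤f))

  ∏ : ∀ {n} → (Fin n → Carrier) → Carrier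
  ∏ = foldr _∙_ 1q

  ∏-cong : ∀ {n} {w v : Fin n → Carrier} → (∀ j → w j ≈ v j) → ∏ w ≈ ∏ v
  ∏-cong {zero}  w≈v = Eq.refl
  ∏-cong {suc n} w≈v = ∙-cong (w≈v zero) (∏-cong (w≈v ∘ suc))

  ∏-updateAt : ∀ {A : Set ℓ} {n} (f : Fin n → A → Carrier) (i : Fin n) (g : A → Carrier)
               (u : Fin n → A) →
               ∏ (λ j → updateAt f i (const g) j (u j)) ≈
               (g (u i) ∙ ∏ (λ j → updateAt f i (const (const 1q)) j (u j)))
  ∏-updateAt {n = suc n} f zero    g u = ∙-cong Eq.refl (Eq.sym (∙-unitˡ _))
  ∏-updateAt {n = suc n} f (suc i) g u =
    Eq.trans (∙-cong Eq.refl (∏-updateAt (f ∘ suc) i g (u ∘ suc))) (x∙yz≈y∙xz _ _ _)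

  ≤-resp-≡ : ∀ {A : Set ℓ} {K : A → Carrier} {a b} → a ≡ b → K a ≤ K b
  ≤-resp-≡ ≡.refl = refl

  ⟦_⟧ : Set ℓ → Carrier
  ⟦ P ⟧ = ⋁ {P} (const 1q)

  ⟦⟧-intro : ∀ {P} → P → 1q ≤ ⟦ P ⟧
  ⟦⟧-intro = ⋁-upper (const 1q)

  ⟦⟧-least : ∀ {P c} → (P → 1q ≤ c) → ⟦ P ⟧ ≤ c
  ⟦⟧-least = ⋁-least (const 1q) _

  ⟦⟧-cong : ∀ {P R} → P ⇔ R → ⟦ P ⟧ ≈ ⟦ R ⟧
  ⟦⟧-cong P⇔R = antisym (⟦⟧-least (⟦⟧-intro ∘ to P⇔R)) (⟦⟧-least (⟦⟧-intro ∘ from P⇔R))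

  ⟦⟧∙≤⇔ : ∀ {P q c} → ((⟦ P ⟧ ∙ q) ≤ c) ⇔ (P → q ≤ c)
  ⟦⟧∙≤⇔ {P} {q} {c} = begin
      (⟦ P ⟧ ∙ q) ≤ c     ∼⟨ ⋁∙≤⇔ (const 1q) ⟩
      (P → (1q ∙ q) ≤ c)  ∼⟨ Π-cong (λ _ → ≤-congˡ (∙-unitˡ q)) ⟩
      (P → q ≤ c)         ∎
    where open ⇔-Reasoning

  ⟦≡⟧∙≤⇔ : ∀ {A : Set ℓ} {a : A} {q} {K : A → Carrier} →
           (∀ b → (⟦ a ≡ b ⟧ ∙ q) ≤ K b) ⇔ (q ≤ K a)
  ⟦≡⟧∙≤⇔ {a = a} = mk⇔ (λ h → to ⟦⟧∙≤⇔ (h a) ≡.refl)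
                        (λ q≤Ka b → from ⟦⟧∙≤⇔ λ { ≡.refl → q≤Ka })

  ⟦⟧-∙ : ∀ {P R} → (⟦ P ⟧ ∙ ⟦ R ⟧) ≈ ⟦ P × R ⟧
  ⟦⟧-∙ = antisym
    (from ⟦⟧∙≤⇔ (λ p → ⟦⟧-least (λ r → ⟦⟧-intro (p , r))))
    (⟦⟧-least (λ (p , r) → trans (reflexive (Eq.sym (∙-unitˡ 1q))) (∙-mono (⟦⟧-intro p) (⟦⟧-intro r))))

  ∏-⟦⟧ : ∀ {n} (P : Fin n → Set ℓ) → ∏ (λ j → ⟦ P j ⟧) ≈ ⟦ (∀ j → P j) ⟧
  ∏-⟦⟧ {zero}  P = antisym (⟦⟧-intro (λ ())) (⟦⟧-least (λ _ → refl))
  ∏-⟦⟧ {suc n} P = Eq.trans (∙-cong Eq.refl (∏-⟦⟧ (P ∘ suc)))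
                  (Eq.trans ⟦⟧-∙ (⟦⟧-cong (mk⇔ (λ (p , ps) → λ { zero → p ; (suc j) → ps j })
                                              (λ ps → ps zero , ps ∘ suc))))

  ⋁-⟦⟧ : ∀ {I : Set ℓ} (P : I → Set ℓ) → ⋁ (λ i → ⟦ P i ⟧) ≈ ⟦ Σ I P ⟧
  ⋁-⟦⟧ P = antisym (⋁-least _ _ (λ i → ⟦⟧-least (λ p → ⟦⟧-intro (i , p))))
                   (⟦⟧-least (λ (i , p) → trans (⟦⟧-intro p) (⋁-upper _ i)))

module QOrderTheory (Q : BaseQuantale ℓ) where
  open QuantaleProperties Q

  module _ {Y X : Setoid ℓ ℓ} (f : Setoid.Carrier Y → Setoid.Carrier X) where
    open Setoid X using () renaming (Carrier to |X|; _≈_ to _≈X_)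

    image-bounded⇔ : ∀ {M q} {K : |X| → Carrier} → (∀ {x x′} → x ≈X x′ → K x ≤ K x′) →
                     (∀ x → (image Q {Y} {X} f M x ∙ q) ≤ K x) ⇔ (∀ a → (M a ∙ q) ≤ K (f a))
    image-bounded⇔ {M} K-resp = mk⇔
      (λ h a → to (⋁∙≤⇔ (M ∘ proj₁)) (h (f a)) (a , Setoid.refl X))
      (λ h x → from (⋁∙≤⇔ (M ∘ proj₁)) (λ (a , fa≈x) → trans (h a) (K-resp fa≈x)))

  module QOrderProperties {X : Setoid ℓ ℓ} {e : Setoid.Carrier X → Setoid.Carrier X → Carrier}
                          (isQOrder : IsQOrder Q X e) where
    open Setoid X using () renaming (Carrier to |X|; _≈_ to _≈X_)
    open IsQOrder isQOrder

    -- q lies below the degree ⋀ₓ (M x ⇒ e x y) to which y is an upper bound of M.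
    BoundedBy : (|X| → Carrier) → |X| → Carrier → Set ℓ
    BoundedBy M y q = ∀ x → (M x ∙ q) ≤ e x y

    e-respˡ : ∀ {x x′ y} → x ≈X x′ → e x y ≤ e x′ y
    e-respˡ x≈x′ = reflexive (e-cong x≈x′ (Setoid.refl X))

    ≤e-congˡ : ∀ {q x x′ y} → x ≈X x′ → (q ≤ e x y) ⇔ (q ≤ e x′ y)
    ≤e-congˡ x≈x′ = ≤-congʳ (e-cong x≈x′ (Setoid.refl X))

    isQJoin⇔ : ∀ {M s} → IsQJoin Q e M s ⇔ (∀ y q → (q ≤ e s y) ⇔ BoundedBy M y q)
    isQJoin⇔ {M} {s} = mk⇔
      (λ (M≤s , ⋀≤s) y q → mk⇔
        (λ q≤sy x → trans (∙-mono (M≤s x) q≤sy) (e-trans x s y))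
        (λ bounded → trans (from (≤⋀⇔ _) (λ x → to residuated (bounded x))) (⋀≤s y)))
      (λ cone →
        (λ x → trans (reflexive (Eq.sym (∙-unitʳ (M x)))) (to (cone s 1q) (e-refl s) x)) ,
        (λ y → from (cone y _) (λ x → from residuated (to (≤⋀⇔ _) refl x))))

    ≈-yoneda : ∀ {u v} → (∀ y q → (q ≤ e u y) ⇔ (q ≤ e v y)) → u ≈X v
    ≈-yoneda {u} {v} same = e-antisym (from (same v 1q) (e-refl v)) (to (same u 1q) (e-refl u))

    qJoin-unique : ∀ {M s s′} → IsQJoin Q e M s → IsQJoin Q e M s′ → s ≈X s′
    qJoin-unique s-join s′-join = ≈-yoneda (λ y q →
      ⇔.trans (to isQJoin⇔ s-join y q) (⇔.sym (to isQJoin⇔ s′-join y q)))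

    module _ {Y : Setoid ℓ ℓ} (f : Setoid.Carrier Y → |X|) where

      image-isQJoin⇔ : ∀ {M t} → IsQJoin Q e (image Q {Y} {X} f M) t ⇔
                       (∀ y q → (q ≤ e t y) ⇔ (∀ a → (M a ∙ q) ≤ e (f a) y))
      image-isQJoin⇔ = mk⇔
        (λ join y q → ⇔.trans (to isQJoin⇔ join y q) image-bounded)
        (λ cone → from isQJoin⇔ (λ y q → ⇔.trans (cone y q) (⇔.sym image-bounded)))
        where
        image-bounded : ∀ {M q y} → BoundedBy (image Q {Y} {X} f M) y q ⇔ (∀ a → (M a ∙ q) ≤ e (f a) y)
        image-bounded = image-bounded⇔ {Y} {X} f e-respˡ

    module _ {Y : Setoid ℓ ℓ} {eY : Setoid.Carrier Y → Setoid.Carrier Y → Carrier} where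

      QJoinPreserving-resp : ∀ {f g : Setoid.Carrier Y → |X|} → (∀ a → f a ≈X g a) →
                             QJoinPreserving Q {Y} {X} eY e f → QJoinPreserving Q {Y} {X} eY e g
      QJoinPreserving-resp {f} {g} f≈g f-pres M s s-join = from (image-isQJoin⇔ {Y} g) λ y q →
        ⇔.trans (≤e-congˡ (Setoid.sym X (f≈g s)))
        (⇔.trans (to (image-isQJoin⇔ {Y} f) (f-pres M s s-join) y q)
                 (Π-cong λ a → ≤e-congˡ (f≈g a)))

      preserving-image-cone : ∀ {g : Setoid.Carrier Y → |X|} →
        (∀ {a b} → Setoid._≈_ Y a b → g a ≈X g b) → QJoinPreserving Q {Y} {X} eY e g →
        ∀ {I : Set ℓ} {p : I → Setoid.Carrier Y} {w : I → Carrier} {s} →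
        IsQJoin Q eY (image Q {≡.setoid I} {Y} p w) s →
        ∀ y q → (q ≤ e (g s) y) ⇔ (∀ i → (w i ∙ q) ≤ e (g (p i)) y)
      preserving-image-cone {g} g-cong g-pres {I} {p} s-join y q =
        ⇔.trans (to (image-isQJoin⇔ {Y} g) (g-pres _ _ s-join) y q)
                (image-bounded⇔ {≡.setoid I} {Y} p (e-respˡ ∘ g-cong))

  module QSupLatticeProperties
    {X : Setoid ℓ ℓ} {e : Setoid.Carrier X → Setoid.Carrier X → Carrier}
    (isQOrder : IsQOrder Q X e) (⨆ : (Setoid.Carrier X → Carrier) → Setoid.Carrier X)
    (⨆-isJoin : ∀ M → IsQJoin Q e M (⨆ M)) where
    open Setoid X using () renaming (Carrier to |X|; _≈_ to _≈X_)
    open QOrderProperties isQOrder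
    open Vector using (_∷_)

    ⨆[_]_ : ∀ {I : Set ℓ} → (I → Carrier) → (I → |X|) → |X|
    ⨆[_]_ {I} w p = ⨆ (image Q {≡.setoid I} {X} p w)

    ⨆[]-cone : ∀ {I : Set ℓ} {w : I → Carrier} {p : I → |X|} y q →
               (q ≤ e (⨆[ w ] p) y) ⇔ (∀ i → (w i ∙ q) ≤ e (p i) y)
    ⨆[]-cone {I} {w} {p} = to (image-isQJoin⇔ {≡.setoid I} p) (⨆-isJoin _)

    Congruent : ∀ {n} → ((Fin n → |X|) → |X|) → Set ℓ
    Congruent O = ∀ {xs ys} → (∀ j → xs j ≈X ys j) → O xs ≈X O ys

    SeparatelyQJoinPreserving : ∀ {n} → ((Fin n → |X|) → |X|) → Set ℓ
    SeparatelyQJoinPreserving O =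
      ∀ xs i → QJoinPreserving Q {X} {X} e e (λ x → O (updateAt xs i (const x)))

    module _ {n} {O : (Fin (suc n) → |X|) → |X|} (O-cong : Congruent O) where

      ∷-η : ∀ xs → O (head xs ∷ tail xs) ≈X O xs
      ∷-η xs = O-cong λ { zero → Setoid.refl X ; (suc j) → Setoid.refl X }

      fixHead-congruent : ∀ x → Congruent (O ∘ (x ∷_))
      fixHead-congruent x xs≈ys = O-cong λ { zero → Setoid.refl X ; (suc j) → xs≈ys j }

      fixHead-preserving : SeparatelyQJoinPreserving O → ∀ x → SeparatelyQJoinPreserving (O ∘ (x ∷_))
      fixHead-preserving O-pres x xs j = QJoinPreserving-resp {X} {e}
        (λ _ → O-cong λ { zero → Setoid.refl X ; (suc k) → Setoid.refl X })
        (O-pres (x ∷ xs) (suc j))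

      varyHead-congruent : ∀ xs {x x′} → x ≈X x′ → O (x ∷ xs) ≈X O (x′ ∷ xs)
      varyHead-congruent xs x≈x′ = O-cong λ { zero → x≈x′ ; (suc j) → Setoid.refl X }

      varyHead-preserving : SeparatelyQJoinPreserving O →
                            ∀ xs → QJoinPreserving Q {X} {X} e e (λ x → O (x ∷ tail xs))
      varyHead-preserving O-pres xs = QJoinPreserving-resp {X} {e}
        (λ _ → O-cong λ { zero → Setoid.refl X ; (suc k) → Setoid.refl X })
        (O-pres xs zero)

    separatelyPreserving-cone :
      ∀ {n} {O : (Fin n → |X|) → |X|} → Congruent O → SeparatelyQJoinPreserving O →
      ∀ {I : Set ℓ} (W : Fin n → I → Carrier) (p : I → |X|) y q →
      (q ≤ e (O (λ j → ⨆[ W j ] p)) y) ⇔ (∀ ts → (∏ (λ j → W j (ts j)) ∙ q) ≤ e (O (p ∘ ts)) y)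
    separatelyPreserving-cone {zero} O-cong O-pres W p y q = mk⇔
      (λ h ts → trans (reflexive (∙-unitˡ q)) (trans h (e-respˡ (O-cong λ ()))))
      (λ h → trans (reflexive (Eq.sym (∙-unitˡ q))) (trans (h λ ()) (e-respˡ (O-cong λ ()))))
    separatelyPreserving-cone {suc m} {O} O-cong O-pres W p y q = begin
      q ≤ e (O v) y
        ∼⟨ ≤e-congˡ (Setoid.sym X (∷-η O-cong v)) ⟩
      q ≤ e (O (head v ∷ tail v)) y
        ∼⟨ preserving-image-cone {X} {e} (varyHead-congruent O-cong (tail v))
             (varyHead-preserving O-cong O-pres v) (⨆-isJoin _) y q ⟩
      (∀ t → (W zero t ∙ q) ≤ e (O (p t ∷ tail v)) y)
        ∼⟨ Π-cong (λ t → separatelyPreserving-cone (fixHead-congruent O-cong (p t))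
                           (fixHead-preserving O-cong O-pres (p t)) (W ∘ suc) p y (W zero t ∙ q)) ⟩
      (∀ t ts → (∏ (λ j → W (suc j) (ts j)) ∙ (W zero t ∙ q)) ≤ e (O (p t ∷ p ∘ ts)) y)
        ∼⟨ uncurry-tuples ⟩
      (∀ ts → (∏ (λ j → W j (ts j)) ∙ q) ≤ e (O (p ∘ ts)) y) ∎
      where
      open ⇔-Reasoning
      v : Fin (suc m) → |X|
      v j = ⨆[ W j ] p

      uncurry-tuples :
        (∀ t ts → (∏ (λ j → W (suc j) (ts j)) ∙ (W zero t ∙ q)) ≤ e (O (p t ∷ p ∘ ts)) y) ⇔
        (∀ ts → (∏ (λ j → W j (ts j)) ∙ q) ≤ e (O (p ∘ ts)) y)
      uncurry-tuples = mk⇔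
        (λ h ts → trans (reflexive (xy∙z≈y∙xz _ _ q))
                        (trans (h (ts zero) (ts ∘ suc)) (e-respˡ (∷-η O-cong (p ∘ ts)))))
        (λ h t ts → trans (reflexive (Eq.sym (xy∙z≈y∙xz _ _ q)))
                          (trans (h (t ∷ ts)) (e-respˡ (Setoid.sym X (∷-η O-cong (p ∘ (t ∷ ts)))))))

module QSubsets (Q : BaseQuantale ℓ) (T : Set ℓ) where
  open QuantaleProperties Q
  open QOrderTheory Q

  QSubset : Set ℓ
  QSubset = T → Carrier

  _≐_ : QSubset → QSubset → Set ℓ
  M ≐ N = ∀ t → M t ≈ N t

  QSubset-setoid : Setoid ℓ ℓ
  QSubset-setoid = record
    { Carrier = QSubset
    ; _≈_ = _≐_
    ; isEquivalence = record
      { refl  = λ t → Eq.refl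
      ; sym   = λ M≐N t → Eq.sym (M≐N t)
      ; trans = λ L≐M M≐N t → Eq.trans (L≐M t) (M≐N t) } }

  subsethood : QSubset → QSubset → Carrier
  subsethood M N = ⋀ (λ t → M t ⇒ N t)

  subsethood-cone : ∀ {M N q} → (q ≤ subsethood M N) ⇔ (∀ t → (M t ∙ q) ≤ N t)
  subsethood-cone = ⇔.trans (≤⋀⇔ _) (Π-cong λ _ → ⇔.sym residuated)

  subsethood-isQOrder : IsQOrder Q QSubset-setoid subsethood
  subsethood-isQOrder = record
    { e-cong = λ M≐M′ N≐N′ → antisym (≤-subsethood M≐M′ N≐N′) (≤-subsethood (sym≐ M≐M′) (sym≐ N≐N′))
    ; e-refl = λ M → from subsethood-cone (λ t → reflexive (∙-unitʳ (M t)))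
    ; e-trans = λ L M N → from subsethood-cone λ t → begin
        L t ∙ (subsethood L M ∙ subsethood M N) ≈⟨ ∙-assoc _ _ _ ⟨
        (L t ∙ subsethood L M) ∙ subsethood M N ≤⟨ ∙-monoˡ _ (to subsethood-cone refl t) ⟩
        M t ∙ subsethood M N                    ≤⟨ to subsethood-cone refl t ⟩
        N t                                     ∎
    ; e-antisym = λ 1≤MN 1≤NM t → antisym (below 1≤MN t) (below 1≤NM t)
    }
    where
    open ≤-Reasoning
    sym≐ : ∀ {M N} → M ≐ N → N ≐ M
    sym≐ M≐N t = Eq.sym (M≐N t)
    ≤-subsethood : ∀ {M M′ N N′} → M ≐ M′ → N ≐ N′ → subsethood M N ≤ subsethood M′ N′
    ≤-subsethood M≐M′ N≐N′ = from subsethood-cone λ t →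
      trans (∙-monoˡ _ (reflexive (Eq.sym (M≐M′ t))))
            (trans (to subsethood-cone refl t) (reflexive (N≐N′ t)))
    below : ∀ {M N} → 1q ≤ subsethood M N → ∀ t → M t ≤ N t
    below {M} 1≤MN t = trans (reflexive (Eq.sym (∙-unitʳ (M t)))) (to subsethood-cone 1≤MN t)

  open QOrderProperties subsethood-isQOrder

  ⋃ : (QSubset → Carrier) → QSubset
  ⋃ Φ t = ⋁ (λ N → Φ N ∙ N t)

  ⋃∙≤⇔ : ∀ {Φ t q c} → ((⋃ Φ t ∙ q) ≤ c) ⇔ (∀ N → (N t ∙ (Φ N ∙ q)) ≤ c)
  ⋃∙≤⇔ {Φ} {t} {q} = ⇔.trans (⋁∙≤⇔ _) (Π-cong λ N → ≤-congˡ (xy∙z≈y∙xz (Φ N) (N t) q))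

  -- Joins of Q-subsets are pointwise, so maps whose cones are pointwise in N preserve them.
  module _ {X : Setoid ℓ ℓ} {e : Setoid.Carrier X → Setoid.Carrier X → Carrier}
           {Z : Set ℓ} (π : Z → T) (c : Setoid.Carrier X → Z → Carrier) (g : QSubset → Setoid.Carrier X)
           (g-cone : ∀ N {y q} → (q ≤ e (g N) y) ⇔ (∀ z → (N (π z) ∙ q) ≤ c y z)) where

    cone-at-⋃ : ∀ {Φ S} → S ≐ ⋃ Φ → ∀ y q → (q ≤ e (g S) y) ⇔ (∀ N → (Φ N ∙ q) ≤ e (g N) y)
    cone-at-⋃ {Φ} {S} S≐⋃Φ y q = begin
      q ≤ e (g S) y                           ∼⟨ g-cone S ⟩
      (∀ z → (S (π z) ∙ q) ≤ c y z)           ∼⟨ Π-cong (λ z → ≤-congˡ (∙-cong (S≐⋃Φ (π z)) Eq.refl)) ⟩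
      (∀ z → (⋃ Φ (π z) ∙ q) ≤ c y z)         ∼⟨ Π-cong (λ z → ⋃∙≤⇔) ⟩
      (∀ z N → (N (π z) ∙ (Φ N ∙ q)) ≤ c y z) ∼⟨ Π-swap ⟩
      (∀ N z → (N (π z) ∙ (Φ N ∙ q)) ≤ c y z) ∼⟨ Π-cong (λ N → ⇔.sym (g-cone N)) ⟩
      (∀ N → (Φ N ∙ q) ≤ e (g N) y)           ∎
      where open ⇔-Reasoning

  ⋃-isJoin : ∀ Φ → IsQJoin Q subsethood Φ (⋃ Φ)
  ⋃-isJoin Φ = from isQJoin⇔
    (cone-at-⋃ {QSubset-setoid} {subsethood} id (λ Y t → Y t) id (λ _ → subsethood-cone) (λ t → Eq.refl))

  join-pointwise : ∀ {Φ S} → IsQJoin Q subsethood Φ S → S ≐ ⋃ Φ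
  join-pointwise S-join = qJoin-unique S-join (⋃-isJoin _)

  represented⇒preserving :
    ∀ {X : Setoid ℓ ℓ} {e : Setoid.Carrier X → Setoid.Carrier X → Carrier} → IsQOrder Q X e →
    ∀ {Z : Set ℓ} (π : Z → T) (c : Setoid.Carrier X → Z → Carrier) (g : QSubset → Setoid.Carrier X) →
    (∀ N {y q} → (q ≤ e (g N) y) ⇔ (∀ z → (N (π z) ∙ q) ≤ c y z)) →
    QJoinPreserving Q {QSubset-setoid} {X} subsethood e g
  represented⇒preserving {X} {e} X-isQOrder π c g g-cone Φ S S-join =
    from (QOrderProperties.image-isQJoin⇔ X-isQOrder {QSubset-setoid} g)
         (cone-at-⋃ {X} {e} π c g g-cone (join-pointwise S-join))

module FreeQSupAlgebra (Q : BaseQuantale ℓ) (Ω : Signature ℓ) (V : Set ℓ) where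
  open QuantaleProperties Q
  open QOrderTheory Q
  open Signature Ω

  data Term : Set ℓ where
    var  : V → Term
    node : (σ : Sym) → Vec Term (arity σ) → Term

  mkNode : (σ : Sym) → (Fin (arity σ) → Term) → Term
  mkNode σ ts = node σ (tabulate ts)

  open QSubsets Q Term public

  opF : (σ : Sym) → (Fin (arity σ) → QSubset) → QSubset
  opF σ Ms = image Q {≡.setoid (Fin (arity σ) → Term)} {≡.setoid Term} (mkNode σ)
                   (λ ts → ∏ (λ j → Ms j (ts j)))

  opF-cong : ∀ σ {Ms Ns} → (∀ j → Ms j ≐ Ns j) → opF σ Ms ≐ opF σ Ns
  opF-cong σ Ms≐Ns s = ⋁-cong (λ (ts , _) → ∏-cong (λ j → Ms≐Ns j (ts j)))

  opF-cone : ∀ σ {Ms Y q} → (q ≤ subsethood (opF σ Ms) Y) ⇔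
                            (∀ ts → (∏ (λ j → Ms j (ts j)) ∙ q) ≤ Y (mkNode σ ts))
  opF-cone σ = ⇔.trans subsethood-cone
    (image-bounded⇔ {Y = ≡.setoid _} {X = ≡.setoid Term} (mkNode σ) ≤-resp-≡)

  module _ (σ : Sym) (Ms : Fin (arity σ) → QSubset) (i : Fin (arity σ)) where

    others : (Fin (arity σ) → Term) → Carrier
    others ts = ∏ (λ j → updateAt Ms i (const (const 1q)) j (ts j))

    opF-updateAt-cone : ∀ N {Y q} → (q ≤ subsethood (opF σ (updateAt Ms i (const N))) Y) ⇔
                        (∀ ts → (N (ts i) ∙ q) ≤ (others ts ⇒ Y (mkNode σ ts)))
    opF-updateAt-cone N {Y} {q} = ⇔.trans (opF-cone σ {updateAt Ms i (const N)}) (Π-cong λ ts →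
      ⇔.trans (≤-congˡ (Eq.trans (∙-cong (∏-updateAt Ms i N ts) Eq.refl)
                                 (xy∙z≈y∙xz (N (ts i)) (others ts) q)))
              residuated)

    opF-preserving : QJoinPreserving Q {QSubset-setoid} {QSubset-setoid} subsethood subsethood
                                     (λ N → opF σ (updateAt Ms i (const N)))
    opF-preserving = represented⇒preserving subsethood-isQOrder (λ ts → ts i)
                       (λ Y ts → others ts ⇒ Y (mkNode σ ts)) _ opF-updateAt-cone

  F : SupAlg Q Ω
  F = record
    { setoid = QSubset-setoid
    ; e = subsethood
    ; isQOrder = subsethood-isQOrder
    ; ⨆ = ⋃
    ; ⨆-isJoin = ⋃-isJoin
    ; op = opF
    ; op-cong = opF-cong
    ; op-preserves = opF-preserving
    }

  single : Term → QSubset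
  single t s = ⟦ t ≡ s ⟧

  η : V → QSubset
  η x = single (var x)

  open QOrderProperties subsethood-isQOrder

  single-cone : ∀ {t Y q} → (q ≤ subsethood (single t) Y) ⇔ (q ≤ Y t)
  single-cone = ⇔.trans subsethood-cone ⟦≡⟧∙≤⇔

  single-isQJoin : ∀ M → IsQJoin Q subsethood (image Q {≡.setoid Term} {QSubset-setoid} single M) M
  single-isQJoin M = from (image-isQJoin⇔ {≡.setoid Term} single) λ Y q →
    ⇔.trans subsethood-cone (Π-cong λ t → ⇔.sym single-cone)

  single-node : ∀ σ (us : Vec Term (arity σ)) → single (node σ us) ≐ opF σ (λ j → single (lookup us j))
  single-node σ us s = Eq.sym (begin-equality
    opF σ (λ j → single (lookup us j)) s
      ≈⟨ ⋁-cong (λ (ts , _) → ∏-⟦⟧ (λ j → lookup us j ≡ ts j)) ⟩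
    ⋁ (λ ((ts , _) : Σ _ (λ ts → mkNode σ ts ≡ s)) → ⟦ (∀ j → lookup us j ≡ ts j) ⟧)
      ≈⟨ ⋁-⟦⟧ _ ⟩
    ⟦ Decomposition ⟧
      ≈⟨ ⟦⟧-cong (mk⇔ assemble decompose) ⟩
    ⟦ node σ us ≡ s ⟧ ∎)
    where
    open ≤-Reasoning
    Decomposition : Set _
    Decomposition = Σ (Σ _ (λ ts → mkNode σ ts ≡ s)) (λ (ts , _) → ∀ j → lookup us j ≡ ts j)

    assemble : Decomposition → node σ us ≡ s
    assemble ((ts , ts↦s) , us≗ts) =
      ≡.trans (≡.cong (node σ) (≡.trans (≡.sym (tabulate∘lookup us)) (tabulate-cong us≗ts))) ts↦s

    decompose : node σ us ≡ s → Decomposition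
    decompose us↦s = (lookup us , ≡.trans (≡.cong (node σ) (tabulate∘lookup us)) us↦s) , λ _ → ≡.refl

module Extension {Q : BaseQuantale ℓ} {Ω : Signature ℓ} {V : Set ℓ}
                 (A : SupAlg Q Ω) (f : V → SupAlg.Carrier A) where
  open QuantaleProperties Q
  open QOrderTheory Q
  open Signature Ω
  open FreeQSupAlgebra Q Ω V
  private module A = SupAlg A
  open A using () renaming (Carrier to |A|; _≈_ to _≈A_)
  open QOrderProperties A.isQOrder
  open QSupLatticeProperties A.isQOrder A.⨆ A.⨆-isJoin
  open Data.Vec using (_∷_)

  mutual
    eval : Term → |A|
    eval (var x)     = f x
    eval (node σ us) = A.op σ (lookup (evalVec us))

    evalVec : ∀ {n} → Vec Term n → Vec |A| n
    evalVec []       = []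
    evalVec (u ∷ us) = eval u ∷ evalVec us

  lookup-evalVec : ∀ {n} (us : Vec Term n) j → lookup (evalVec us) j ≡ eval (lookup us j)
  lookup-evalVec (u ∷ us) zero    = ≡.refl
  lookup-evalVec (u ∷ us) (suc j) = lookup-evalVec us j

  eval-node : ∀ σ us → eval (node σ us) ≈A A.op σ (eval ∘ lookup us)
  eval-node σ us = A.op-cong σ (A.reflexive ∘ lookup-evalVec us)

  eval-mkNode : ∀ σ ts → eval (mkNode σ ts) ≈A A.op σ (eval ∘ ts)
  eval-mkNode σ ts = A.trans (eval-node σ (tabulate ts))
                             (A.op-cong σ (A.reflexive ∘ ≡.cong eval ∘ lookup∘tabulate ts))

  ext : QSubset → |A|
  ext M = ⨆[ M ] eval

  ext-cone : ∀ M {y q} → (q ≤ A.e (ext M) y) ⇔ (∀ t → (M t ∙ q) ≤ A.e (eval t) y)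
  ext-cone M = ⨆[]-cone _ _

  ext-cong : ∀ {M N} → M ≐ N → ext M ≈A ext N
  ext-cong {M} {N} M≐N = ≈-yoneda λ y q →
    ⇔.trans (ext-cone M) (⇔.trans (Π-cong λ t → ≤-congˡ (∙-cong (M≐N t) Eq.refl)) (⇔.sym (ext-cone N)))

  ext-preservesJoins : QJoinPreserving Q {QSubset-setoid} {A.setoid} subsethood A.e ext
  ext-preservesJoins = represented⇒preserving A.isQOrder id (λ y t → A.e (eval t) y) ext ext-cone

  ext-preservesOps : ∀ σ Ms → ext (opF σ Ms) ≈A A.op σ (ext ∘ Ms)
  ext-preservesOps σ Ms = ≈-yoneda λ y q → begin
    q ≤ A.e (ext (opF σ Ms)) y
      ∼⟨ ext-cone (opF σ Ms) ⟩
    (∀ s → (opF σ Ms s ∙ q) ≤ A.e (eval s) y)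
      ∼⟨ image-bounded⇔ {Y = ≡.setoid _} {X = ≡.setoid Term} (mkNode σ) ≤-resp-≡ ⟩
    (∀ ts → (∏ (λ j → Ms j (ts j)) ∙ q) ≤ A.e (eval (mkNode σ ts)) y)
      ∼⟨ Π-cong (λ ts → ≤e-congˡ (eval-mkNode σ ts)) ⟩
    (∀ ts → (∏ (λ j → Ms j (ts j)) ∙ q) ≤ A.e (A.op σ (eval ∘ ts)) y)
      ∼⟨ ⇔.sym (separatelyPreserving-cone (A.op-cong σ) (A.op-preserves σ) Ms eval y q) ⟩
    q ≤ A.e (A.op σ (ext ∘ Ms)) y ∎
    where open ⇔-Reasoning

  ext-hom : SupAlgHom Q F A
  ext-hom = record
    { fun = ext
    ; fun-cong = ext-cong
    ; fun-preservesJoins = ext-preservesJoins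
    ; fun-preservesOps = ext-preservesOps
    }

  ext-η : ∀ x → ext (η x) ≈A f x
  ext-η x = ≈-yoneda λ y q → ⇔.trans (ext-cone (η x)) ⟦≡⟧∙≤⇔

  module _ (g : SupAlgHom Q F A) (g∘η≈f : ∀ x → SupAlgHom.fun g (η x) ≈A f x) where
    open SupAlgHom g

    mutual
      fun∘single≈eval : ∀ t → fun (single t) ≈A eval t
      fun∘single≈eval (var x)     = g∘η≈f x
      fun∘single≈eval (node σ us) = begin
        fun (single (node σ us))          ≈⟨ fun-cong (single-node σ us) ⟩
        fun (opF σ (single ∘ lookup us))  ≈⟨ fun-preservesOps σ (single ∘ lookup us) ⟩
        A.op σ (fun ∘ single ∘ lookup us) ≈⟨ A.op-cong σ (fun∘single≈eval-lookup us) ⟩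
        A.op σ (eval ∘ lookup us)         ≈⟨ eval-node σ us ⟨
        eval (node σ us)                  ∎
        where open SetoidReasoning A.setoid

      fun∘single≈eval-lookup : ∀ {n} (us : Vec Term n) j →
                               fun (single (lookup us j)) ≈A eval (lookup us j)
      fun∘single≈eval-lookup (u ∷ us) zero    = fun∘single≈eval u
      fun∘single≈eval-lookup (u ∷ us) (suc j) = fun∘single≈eval-lookup us j

    hom-cone : ∀ M {y q} → (q ≤ A.e (fun M) y) ⇔ (∀ t → (M t ∙ q) ≤ A.e (eval t) y)
    hom-cone M {y} {q} =
      ⇔.trans (preserving-image-cone {QSubset-setoid} {subsethood} fun-cong fun-preservesJoins
                                     (single-isQJoin M) y q)
              (Π-cong λ t → ≤e-congˡ (fun∘single≈eval t))

    hom≈ext : ∀ M → fun M ≈A ext M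
    hom≈ext M = ≈-yoneda λ y q → ⇔.trans (hom-cone M) (⇔.sym (ext-cone M))

mainTheorem3 : {ℓ : Level} (Q : BaseQuantale ℓ) (Ω : Signature ℓ) →
    ForgetfulHasLeftAdjoint Q Ω
mainTheorem3 Q Ω V = F , η , λ A f →
  let open Extension A f in ext-hom , ext-η , hom≈ext
  where open FreeQSupAlgebra Q Ω V using (F; η)
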